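{- Let $n,m\ge0$ be integers, let $[n;m]=\{1,2,\dots,n,\,n+2,n+4,\dots,n+2m\}$, and let $I,J$ be any two subsets of $[n;m]$. Then there exist constants $b_\lambda^{I,J}\in\mathbb C$, $\lambda\in I\cup J$ (depending on $\lambda$, $I$, $J$), such that, as an identity of rational functions in $x$, $$\prod_{\lambda\in I}\frac{x+2+\lambda}{x+2-\lambda}\prod_{\lambda\in J}\frac{x-\lambda}{x+\lambda}+\prod_{\lambda\in I}\frac{x-\lambda}{x+\lambda}\prod_{\lambda\in J}\frac{x+2+\lambda}{x+2-\lambda}=2+\sum_{\lambda\in I\cup J}\frac{b_\lambda^{I,J}}{(x+2-\lambda)(x+\lambda)}.$$ -}

module Defs where

open import Data.Nat as ℕ using (ℕ; zero; suc)
open import Data.Fin using (Fin; zero; suc; toℕ)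
open import Data.Fin.Subset using (Subset; Side; inside; outside)
open import Data.Vec using ([]; _∷_)
open import Data.Rational as ℚ using (ℚ; 0ℚ; 1ℚ; _+_; _*_; _÷_; ≢-nonZero)
open import Data.Rational.Properties using (_≟_)
open import Data.Integer using (+_)
open import Relation.Nullary using (yes; no)

-- The set [n;m] = {1,…,n, n+2, n+4, …, n+2m}, enumerated by Fin (n + m):
-- index i (0-based) with i < n ↦ i+1 ; index n+j (0 ≤ j < m) ↦ n + 2(j+1).
elt : (n m : ℕ) → Fin (n ℕ.+ m) → ℕ
elt zero    m i       = 2 ℕ.* suc (toℕ i)
elt (suc n) m zero    = 1
elt (suc n) m (suc i) = suc (elt n m i)

toℚ : ℕ → ℚ
toℚ k = (+ k) ℚ./ 1

eltℚ : (n m : ℕ) → Fin (n ℕ.+ m) → ℚ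
eltℚ n m i = toℚ (elt n m i)

-- Total division on ℚ: the honest quotient whenever the divisor is nonzero
-- (the statement only ever uses it at nonzero divisors).
_/'_ : ℚ → ℚ → ℚ
p /' q with q ≟ 0ℚ
... | yes _  = 0ℚ
... | no q≢0 = _÷_ p q {{≢-nonZero q≢0}}

prodOver : ∀ {k} → Subset k → (Fin k → ℚ) → ℚ
prodOver []            f = 1ℚ
prodOver (inside  ∷ S) f = f zero * prodOver S (λ i → f (suc i))
prodOver (outside ∷ S) f = prodOver S (λ i → f (suc i))

sumOver : ∀ {k} → Subset k → (Fin k → ℚ) → ℚ
sumOver []            f = 0ℚ
sumOver (inside  ∷ S) f = f zero + sumOver S (λ i → f (suc i))
sumOver (outside ∷ S) f = sumOver S (λ i → f (suc i))

{-# OPTIONS --safe #-}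
module Submission where

-- Put y = x + 1. Then D λ = (x + 2 - λ)(x + λ) = y² - (λ - 1)², the factors of the first product
-- belonging to one λ multiply to 1 + (κ + θ y) / D λ for constants κ, θ, and the second product
-- is the first one with y replaced by -y. By induction on the index set, the first product is
-- 1 + Σ (p λ + y q λ) / D λ with p, q independent of x (and the second is the same expression at
-- -y): after multiplying by a new factor, y² / D λ₀ = 1 + (λ₀ - 1)² / D λ₀ keeps the numerators
-- linear in y, and 1 / (D λ₀ D λ) splits into partial fractions because the (λ - 1)² are pairwise
-- distinct for positive integers λ. Adding the two products cancels the odd parts.

open import Defs
import Algebra.Apartness.Properties.HeytingCommutativeRing as HeytingCommutativeRingProperties
open import Algebra.Bundles using (CommutativeMonoid)
import Algebra.Properties.CommutativeSemigroup as CommutativeSemigroupProperties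
open import Algebra.Properties.Group using (x∙y⁻¹≈ε⇒x≈y)
open import Data.Fin using (Fin; zero; suc)
import Data.Fin.Properties as Fin
open import Data.Fin.Subset using (Subset; Side; inside; outside; _∈_; _∪_)
open import Data.Integer as ℤ using (+0)
import Data.Integer.Properties as ℤ
open import Data.Maybe using (Maybe; just; nothing)
open import Data.Nat using (ℕ; zero; suc; NonZero; pred)
import Data.Nat as ℕ
import Data.Nat.Properties as ℕ
open import Data.Product using (Σ; _×_; _,_; proj₁; proj₂)
open import Data.Rational using (ℚ; mkℚ; 0ℚ; 1ℚ; _+_; _-_; _*_; -_; toℚᵘ; ≢-nonZero)
open import Data.Rational.Properties
  using ( _≟_; 1≢0; ↥p≡0⇒p≡0; +-*-commutativeRing; heytingCommutativeRing; +-0-group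
        ; +-0-commutativeMonoid; *-1-commutativeMonoid
        ; +-identityʳ; *-identityˡ; *-identityʳ; *-zeroˡ; *-zeroʳ; *-assoc; *-comm
        ; *-distribˡ-+; *-distribʳ-+; *-inverseʳ
        ; toℚᵘ-injective; toℚᵘ-fromℚᵘ; fromℚᵘ-injective; toℚᵘ-homo-+; toℚᵘ-homo-* )
import Data.Rational.Unnormalised as ℚᵘ
import Data.Rational.Unnormalised.Properties as ℚᵘ
open import Data.Vec using (_∷_; []; here; there)
import Data.Vec.Functional as Vector
open import Function using (_∘_)
open import Function.Definitions using (Injective)
open import Level using (0ℓ)
open import Relation.Binary using (tri<; tri≈; tri>)
open import Relation.Binary.PropositionalEquality
open import Relation.Nullary using (yes; no; contradiction)
open import Tactic.RingSolver using (solve-∀)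
import Tactic.RingSolver.Core.AlmostCommutativeRing as ACR

open ≡-Reasoning
open HeytingCommutativeRingProperties heytingCommutativeRing using (x#0y#0→xy#0)
open CommutativeSemigroupProperties (CommutativeMonoid.commutativeSemigroup +-0-commutativeMonoid)
  using () renaming (interchange to +-interchange)
open CommutativeSemigroupProperties (CommutativeMonoid.commutativeSemigroup *-1-commutativeMonoid)
  using () renaming (interchange to *-interchange)

-- Sound but incomplete, which is all the solver needs; deciding `0ℚ ≟ q` instead makes the
-- solver very slow.
zero? : ∀ q → Maybe (0ℚ ≡ q)
zero? q@(mkℚ +0 _ _) = just (sym (↥p≡0⇒p≡0 q refl))
zero? _              = nothing

ring : ACR.AlmostCommutativeRing 0ℓ 0ℓ
ring = ACR.fromCommutativeRing +-*-commutativeRing zero?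

/'-as-* : ∀ p q → p /' q ≡ p * (1ℚ /' q)
/'-as-* p q with q ≟ 0ℚ
... | yes _ = sym (*-zeroʳ p)
... | no _  = cong (p *_) (sym (*-identityˡ _))

1/'-inverseʳ : ∀ {q} → q ≢ 0ℚ → q * (1ℚ /' q) ≡ 1ℚ
1/'-inverseʳ {q} q≢0 with q ≟ 0ℚ
... | yes q≡0  = contradiction q≡0 q≢0
... | no  q≢0′ = trans (cong (q *_) (*-identityˡ _)) (*-inverseʳ q {{≢-nonZero q≢0′}})

1/'-factorˡ : ∀ u v w → u * v * w ≡ 1ℚ → 1ℚ /' u ≡ v * w
1/'-factorˡ u v w uvw≡1 = begin
  1ℚ /' u                  ≡⟨ sym (*-identityʳ _) ⟩
  1ℚ /' u * 1ℚ             ≡⟨ cong (1ℚ /' u *_) (sym uvw≡1) ⟩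
  1ℚ /' u * (u * v * w)    ≡⟨ regroup (1ℚ /' u) u v w ⟩
  u * (1ℚ /' u) * (v * w)  ≡⟨ cong (_* (v * w)) (1/'-inverseʳ u≢0) ⟩
  1ℚ * (v * w)             ≡⟨ *-identityˡ _ ⟩
  v * w                    ∎
  where
  regroup : ∀ i a b c → i * (a * b * c) ≡ a * i * (b * c)
  regroup = solve-∀ ring
  u≢0 : u ≢ 0ℚ
  u≢0 u≡0 = 1≢0 (begin
    1ℚ          ≡⟨ sym uvw≡1 ⟩
    u * v * w   ≡⟨ cong (λ t → t * v * w) u≡0 ⟩
    0ℚ * v * w  ≡⟨ cong (_* w) (*-zeroˡ v) ⟩
    0ℚ * w      ≡⟨ *-zeroˡ w ⟩
    0ℚ          ∎)

1/'-factorʳ : ∀ u v w → u * v * w ≡ 1ℚ → 1ℚ /' v ≡ u * w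
1/'-factorʳ u v w uvw≡1 = 1/'-factorˡ v u w (trans (cong (_* w) (*-comm v u)) uvw≡1)

+-*-inverse : ∀ d c {w} → d * w ≡ 1ℚ → (d + c) * w ≡ 1ℚ + c * w
+-*-inverse d c {w} dw≡1 = trans (*-distribʳ-+ w d c) (cong (_+ c * w) dw≡1)

fraction-expansionˡ : ∀ u v n c {w} → u * v * w ≡ 1ℚ → n * v ≡ u * v + c →
                      n /' u ≡ 1ℚ + c * w
fraction-expansionˡ u v n c {w} uvw≡1 nv≡uv+c = begin
  n /' u           ≡⟨ /'-as-* n u ⟩
  n * (1ℚ /' u)    ≡⟨ cong (n *_) (1/'-factorˡ u v w uvw≡1) ⟩
  n * (v * w)      ≡⟨ sym (*-assoc n v w) ⟩
  n * v * w        ≡⟨ cong (_* w) nv≡uv+c ⟩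
  (u * v + c) * w  ≡⟨ +-*-inverse (u * v) c uvw≡1 ⟩
  1ℚ + c * w       ∎

fraction-expansionʳ : ∀ u v n c {w} → u * v * w ≡ 1ℚ → n * u ≡ u * v + c →
                      n /' v ≡ 1ℚ + c * w
fraction-expansionʳ u v n c {w} uvw≡1 nu≡uv+c = fraction-expansionˡ v u n c
  (trans (cong (_* w) (*-comm v u)) uvw≡1) (trans nu≡uv+c (cong (_+ c) (*-comm u v)))

fraction-product-expansion : ∀ u v n n′ c {w} → u * v * w ≡ 1ℚ → n * n′ ≡ u * v + c →
                             n /' u * (n′ /' v) ≡ 1ℚ + c * w
fraction-product-expansion u v n n′ c {w} uvw≡1 nn′≡uv+c = begin
  n /' u * (n′ /' v)                ≡⟨ cong₂ _*_ (/'-as-* n u) (/'-as-* n′ v) ⟩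
  n * (1ℚ /' u) * (n′ * (1ℚ /' v))  ≡⟨ cong₂ (λ s t → n * s * (n′ * t))
                                             (1/'-factorˡ u v w uvw≡1) (1/'-factorʳ u v w uvw≡1) ⟩
  n * (v * w) * (n′ * (u * w))      ≡⟨ regroup n n′ u v w ⟩
  n * n′ * (u * v * w) * w          ≡⟨ cong (λ t → n * n′ * t * w) uvw≡1 ⟩
  n * n′ * 1ℚ * w                   ≡⟨ cong (_* w) (*-identityʳ (n * n′)) ⟩
  n * n′ * w                        ≡⟨ cong (_* w) nn′≡uv+c ⟩
  (u * v + c) * w                   ≡⟨ +-*-inverse (u * v) c uvw≡1 ⟩
  1ℚ + c * w                        ∎
  where
  regroup : ∀ a a′ b b′ r → a * (b′ * r) * (a′ * (b * r)) ≡ a * a′ * (b * b′ * r) * r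
  regroup = solve-∀ ring

partial-fraction : ∀ d e w v z → d * w ≡ 1ℚ → e * v ≡ 1ℚ → (e - d) * z ≡ 1ℚ →
                   w * v ≡ z * (w - v)
partial-fraction d e w v z dw≡1 ev≡1 [e-d]z≡1 = begin
  w * v                        ≡⟨ sym (*-identityˡ _) ⟩
  1ℚ * (w * v)                 ≡⟨ cong (_* (w * v)) (sym [e-d]z≡1) ⟩
  (e - d) * z * (w * v)        ≡⟨ regroup e d z w v ⟩
  z * (e * v * w - d * w * v)  ≡⟨ cong₂ (λ s t → z * (s * w - t * v)) ev≡1 dw≡1 ⟩
  z * (1ℚ * w - 1ℚ * v)        ≡⟨ cong₂ (λ s t → z * (s - t)) (*-identityˡ w) (*-identityˡ v) ⟩
  z * (w - v)                  ∎
  where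
  regroup : ∀ a b c r s → (a - b) * c * (r * s) ≡ c * (a * s * r - b * r * s)
  regroup = solve-∀ ring

toℚᵘ-toℚ : ∀ a → toℚᵘ (toℚ a) ℚᵘ.≃ ℚᵘ.mkℚᵘ (ℤ.+ a) 0
toℚᵘ-toℚ a = toℚᵘ-fromℚᵘ (ℚᵘ.mkℚᵘ (ℤ.+ a) 0)

toℚ-via-ℚᵘ : ∀ a q → ℚᵘ.mkℚᵘ (ℤ.+ a) 0 ℚᵘ.≃ toℚᵘ q → toℚ a ≡ q
toℚ-via-ℚᵘ a q a≃q = toℚᵘ-injective (ℚᵘ.≃-trans (toℚᵘ-toℚ a) a≃q)

toℚ-+ : ∀ a b → toℚ (a ℕ.+ b) ≡ toℚ a + toℚ b
toℚ-+ a b = toℚ-via-ℚᵘ (a ℕ.+ b) (toℚ a + toℚ b) (ℚᵘ.≃-trans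
  (ℚᵘ.*≡* (cong (ℤ._* ℤ.+ 1) (sym (cong₂ ℤ._+_ (ℤ.*-identityʳ (ℤ.+ a)) (ℤ.*-identityʳ (ℤ.+ b))))))
  (ℚᵘ.≃-sym (ℚᵘ.≃-trans (toℚᵘ-homo-+ (toℚ a) (toℚ b)) (ℚᵘ.+-cong (toℚᵘ-toℚ a) (toℚᵘ-toℚ b)))))

toℚ-* : ∀ a b → toℚ (a ℕ.* b) ≡ toℚ a * toℚ b
toℚ-* a b = toℚ-via-ℚᵘ (a ℕ.* b) (toℚ a * toℚ b) (ℚᵘ.≃-trans
  (ℚᵘ.*≡* (cong (ℤ._* ℤ.+ 1) (ℤ.pos-* a b)))
  (ℚᵘ.≃-sym (ℚᵘ.≃-trans (toℚᵘ-homo-* (toℚ a) (toℚ b)) (ℚᵘ.*-cong (toℚᵘ-toℚ a) (toℚᵘ-toℚ b)))))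

toℚ-injective : Injective _≡_ _≡_ toℚ
toℚ-injective {a} {b} toℚa≡toℚb = ℤ.+-injective (begin
  ℤ.+ a            ≡⟨ sym (ℤ.*-identityʳ (ℤ.+ a)) ⟩
  ℤ.+ a ℤ.* ℤ.+ 1  ≡⟨ ℚᵘ.drop-*≡* (fromℚᵘ-injective {ℚᵘ.mkℚᵘ (ℤ.+ a) 0} {ℚᵘ.mkℚᵘ (ℤ.+ b) 0}
                                                     toℚa≡toℚb) ⟩
  ℤ.+ b ℤ.* ℤ.+ 1  ≡⟨ ℤ.*-identityʳ (ℤ.+ b) ⟩
  ℤ.+ b            ∎)

square-injective : ∀ {a b} → a ℕ.* a ≡ b ℕ.* b → a ≡ b
square-injective {a} {b} a²≡b² with ℕ.<-cmp a b
... | tri< a<b _ _ = contradiction a²≡b² (ℕ.<⇒≢ (ℕ.*-mono-< a<b a<b))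
... | tri≈ _ a≡b _ = a≡b
... | tri> _ _ b<a = contradiction (sym a²≡b²) (ℕ.<⇒≢ (ℕ.*-mono-< b<a b<a))

sumOver-cong : ∀ {k} (R : Subset k) {f g : Fin k → ℚ} → (∀ i → i ∈ R → f i ≡ g i) →
               sumOver R f ≡ sumOver R g
sumOver-cong []            f≗g = refl
sumOver-cong (inside  ∷ R) f≗g =
  cong₂ _+_ (f≗g zero here) (sumOver-cong R (λ i → f≗g (suc i) ∘ there))
sumOver-cong (outside ∷ R) f≗g = sumOver-cong R (λ i → f≗g (suc i) ∘ there)

sumOver-+ : ∀ {k} (R : Subset k) (f g : Fin k → ℚ) →
            sumOver R (λ i → f i + g i) ≡ sumOver R f + sumOver R g
sumOver-+ []            f g = sym (+-identityʳ 0ℚ)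
sumOver-+ (inside  ∷ R) f g = trans (cong ((f zero + g zero) +_) (sumOver-+ R (f ∘ suc) (g ∘ suc)))
                                    (+-interchange (f zero) (g zero) _ _)
sumOver-+ (outside ∷ R) f g = sumOver-+ R (f ∘ suc) (g ∘ suc)

sumOver-*ˡ : ∀ {k} (R : Subset k) (c : ℚ) (f : Fin k → ℚ) →
             sumOver R (λ i → c * f i) ≡ c * sumOver R f
sumOver-*ˡ []            c f = sym (*-zeroʳ c)
sumOver-*ˡ (inside  ∷ R) c f = trans (cong (c * f zero +_) (sumOver-*ˡ R c (f ∘ suc)))
                                     (sym (*-distribˡ-+ c (f zero) _))
sumOver-*ˡ (outside ∷ R) c f = sumOver-*ˡ R c (f ∘ suc)

sumOver-linear : ∀ {k} (R : Subset k) (c : ℚ) (f g : Fin k → ℚ) →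
                 sumOver R (λ i → c * f i + g i) ≡ c * sumOver R f + sumOver R g
sumOver-linear R c f g =
  trans (sumOver-+ R (λ i → c * f i) g) (cong (_+ sumOver R g) (sumOver-*ˡ R c f))

_^ᵇ_ : ℚ → Side → ℚ
c ^ᵇ inside  = c
c ^ᵇ outside = 1ℚ

prodOver-∷ : ∀ {k} b (S : Subset k) (f : Fin (suc k) → ℚ) →
             prodOver (b ∷ S) f ≡ f zero ^ᵇ b * prodOver S (f ∘ suc)
prodOver-∷ inside  S f = refl
prodOver-∷ outside S f = sym (*-identityˡ _)

prodOver₂ : ∀ {k} → Subset k → Subset k → (Fin k → ℚ) → (Fin k → ℚ) → ℚ
prodOver₂ I J f g = prodOver I f * prodOver J g

prodOver₂-∷ : ∀ {k} bI bJ (I J : Subset k) (f g : Fin (suc k) → ℚ) →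
              prodOver₂ (bI ∷ I) (bJ ∷ J) f g
                ≡ f zero ^ᵇ bI * g zero ^ᵇ bJ * prodOver₂ I J (f ∘ suc) (g ∘ suc)
prodOver₂-∷ bI bJ I J f g = trans (cong₂ _*_ (prodOver-∷ bI I f) (prodOver-∷ bJ J g))
  (*-interchange (f zero ^ᵇ bI) (prodOver I (f ∘ suc)) (g zero ^ᵇ bJ) (prodOver J (g ∘ suc)))

P Q D : ℚ → ℚ → ℚ
P x l = (x + toℚ 2 + l) /' (x + toℚ 2 - l)
Q x l = (x - l) /' (x + l)
D x l = (x + toℚ 2 - l) * (x + l)

σ : ℚ → ℚ
σ l = (l - 1ℚ) * (l - 1ℚ)

D+σ : ∀ x l → (x + toℚ 2 - l) * (x + l) + (l - 1ℚ) * (l - 1ℚ) ≡ (x + 1ℚ) * (x + 1ℚ)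
D+σ = solve-∀ ring

D-difference : ∀ x l l′ → (x + toℚ 2 - l′) * (x + l′) - (x + toℚ 2 - l) * (x + l)
                          ≡ (l - 1ℚ) * (l - 1ℚ) - (l′ - 1ℚ) * (l′ - 1ℚ)
D-difference = solve-∀ ring

square-* : ∀ x l {w} → D x l * w ≡ 1ℚ → (x + 1ℚ) * (x + 1ℚ) * w ≡ 1ℚ + σ l * w
square-* x l {w} Dw≡1 = trans (cong (_* w) (sym (D+σ x l))) (+-*-inverse (D x l) (σ l) Dw≡1)

P-expansion : ∀ x l c {w} → D x l * w ≡ 1ℚ → (x + toℚ 2 + l) * (x + l) ≡ D x l + c →
              P x l ≡ 1ℚ + c * w
P-expansion x l = fraction-expansionˡ (x + toℚ 2 - l) (x + l) (x + toℚ 2 + l)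

Q-expansion : ∀ x l c {w} → D x l * w ≡ 1ℚ → (x - l) * (x + toℚ 2 - l) ≡ D x l + c →
              Q x l ≡ 1ℚ + c * w
Q-expansion x l = fraction-expansionʳ (x + toℚ 2 - l) (x + l) (x - l)

PQ-expansion : ∀ x l c {w} → D x l * w ≡ 1ℚ → (x + toℚ 2 + l) * (x - l) ≡ D x l + c →
               P x l * Q x l ≡ 1ℚ + c * w
PQ-expansion x l = fraction-product-expansion (x + toℚ 2 - l) (x + l) (x + toℚ 2 + l) (x - l)

κ θ : Side → Side → ℚ → ℚ
κ inside  inside  l = - (toℚ 4 * l)
κ inside  outside l = toℚ 2 * l * (l - 1ℚ)
κ outside inside  l = toℚ 2 * l * (l - 1ℚ)
κ outside outside l = 0ℚ
θ inside  inside  l = 0ℚ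
θ inside  outside l = toℚ 2 * l
θ outside inside  l = - (toℚ 2 * l)
θ outside outside l = 0ℚ

factor-expansion : ∀ bI bJ x l {w} → D x l * w ≡ 1ℚ →
    P x l ^ᵇ bI * Q x l ^ᵇ bJ ≡ 1ℚ + (κ bI bJ l + θ bI bJ l * (x + 1ℚ)) * w
  × Q x l ^ᵇ bI * P x l ^ᵇ bJ ≡ 1ℚ + (κ bI bJ l + θ bI bJ l * - (x + 1ℚ)) * w
factor-expansion inside inside x l Dw≡1 =
    PQ-expansion x l _ Dw≡1 (numerator x l)
  , trans (*-comm (Q x l) (P x l)) (PQ-expansion x l _ Dw≡1 (numerator′ x l))
  where
  numerator : ∀ x l → (x + toℚ 2 + l) * (x - l)
                    ≡ (x + toℚ 2 - l) * (x + l) + (- (toℚ 4 * l) + 0ℚ * (x + 1ℚ))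
  numerator = solve-∀ ring
  numerator′ : ∀ x l → (x + toℚ 2 + l) * (x - l)
                     ≡ (x + toℚ 2 - l) * (x + l) + (- (toℚ 4 * l) + 0ℚ * - (x + 1ℚ))
  numerator′ = solve-∀ ring
factor-expansion inside outside x l Dw≡1 =
    trans (*-identityʳ (P x l)) (P-expansion x l _ Dw≡1 (numerator x l))
  , trans (*-identityʳ (Q x l)) (Q-expansion x l _ Dw≡1 (numerator′ x l))
  where
  numerator : ∀ x l → (x + toℚ 2 + l) * (x + l)
                    ≡ (x + toℚ 2 - l) * (x + l) + (toℚ 2 * l * (l - 1ℚ) + toℚ 2 * l * (x + 1ℚ))
  numerator = solve-∀ ring
  numerator′ : ∀ x l → (x - l) * (x + toℚ 2 - l)
                     ≡ (x + toℚ 2 - l) * (x + l) + (toℚ 2 * l * (l - 1ℚ) + toℚ 2 * l * - (x + 1ℚ))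
  numerator′ = solve-∀ ring
factor-expansion outside inside x l Dw≡1 =
    trans (*-identityˡ (Q x l)) (Q-expansion x l _ Dw≡1 (numerator x l))
  , trans (*-identityˡ (P x l)) (P-expansion x l _ Dw≡1 (numerator′ x l))
  where
  numerator : ∀ x l → (x - l) * (x + toℚ 2 - l)
                    ≡ (x + toℚ 2 - l) * (x + l) + (toℚ 2 * l * (l - 1ℚ) + - (toℚ 2 * l) * (x + 1ℚ))
  numerator = solve-∀ ring
  numerator′ : ∀ x l → (x + toℚ 2 + l) * (x + l)
                     ≡ (x + toℚ 2 - l) * (x + l) + (toℚ 2 * l * (l - 1ℚ) + - (toℚ 2 * l) * - (x + 1ℚ))
  numerator′ = solve-∀ ring
factor-expansion outside outside x l {w} _ = no-factor (x + 1ℚ) w , no-factor (- (x + 1ℚ)) w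
  where
  no-factor : ∀ y w → 1ℚ * 1ℚ ≡ 1ℚ + (0ℚ + 0ℚ * y) * w
  no-factor = solve-∀ ring

expansion : ∀ {k} → Subset k → (W p q : Fin k → ℚ) → ℚ → ℚ
expansion R W p q y = 1ℚ + sumOver R (λ i → (p i + y * q i) * W i)

expansion-mirror : ∀ {k} (R : Subset k) (W p q : Fin k → ℚ) y →
  expansion R W p q y + expansion R W p q (- y) ≡ toℚ 2 + sumOver R (λ i → toℚ 2 * p i * W i)
expansion-mirror {k} R W p q y = begin
  1ℚ + sumOver R f + (1ℚ + sumOver R g)
    ≡⟨ pair (sumOver R f) (sumOver R g) ⟩
  toℚ 2 + (sumOver R f + sumOver R g)
    ≡⟨ cong (toℚ 2 +_) (sym (sumOver-+ R f g)) ⟩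
  toℚ 2 + sumOver R (λ i → f i + g i)
    ≡⟨ cong (toℚ 2 +_) (sumOver-cong R (λ i _ → odd-cancels y (p i) (q i) (W i))) ⟩
  toℚ 2 + sumOver R (λ i → toℚ 2 * p i * W i) ∎
  where
  f g : Fin k → ℚ
  f i = (p i + y * q i) * W i
  g i = (p i + - y * q i) * W i
  pair : ∀ s t → 1ℚ + s + (1ℚ + t) ≡ toℚ 2 + (s + t)
  pair = solve-∀ ring
  odd-cancels : ∀ y p q w → (p + y * q) * w + (p + - y * q) * w ≡ toℚ 2 * p * w
  odd-cancels = solve-∀ ring

module Extension {k} (R : Subset k) (z p q : Fin k → ℚ) (a κ θ : ℚ) where

  -- (κ + θ y) (p i + y q i) = even i + y odd i  modulo  y² = a
  even odd : Fin k → ℚ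
  even i = κ * p i + θ * a * q i
  odd  i = θ * p i + κ * q i

  p⁺ q⁺ : Fin (suc k) → ℚ
  p⁺ zero    = κ + sumOver R (λ i → z i * even i)
  p⁺ (suc i) = p i + θ * q i - z i * even i
  q⁺ zero    = θ + sumOver R (λ i → z i * odd i)
  q⁺ (suc i) = q i - z i * odd i

  module _ (W : Fin (suc k) → ℚ) (y : ℚ) (y²w : y * y * W zero ≡ 1ℚ + a * W zero)
           (split : ∀ i → i ∈ R → W zero * W (suc i) ≡ z i * (W zero - W (suc i))) where

    term : ∀ i → i ∈ R →
      (1ℚ + (κ + θ * y) * W zero) * ((p i + y * q i) * W (suc i))
        ≡ W zero * (y * (z i * odd i) + z i * even i) + (p⁺ (suc i) + y * q⁺ (suc i)) * W (suc i)
    term i i∈R = begin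
      (1ℚ + (κ + θ * y) * w) * ((p i + y * q i) * v)
        ≡⟨ expand κ θ y w (p i) (q i) v ⟩
      (p i + y * q i) * v + θ * q i * (y * y * w) * v + (κ * p i + y * odd i) * (w * v)
        ≡⟨ cong (λ t → (p i + y * q i) * v + θ * q i * t * v + (κ * p i + y * odd i) * (w * v)) y²w ⟩
      (p i + y * q i) * v + θ * q i * (1ℚ + a * w) * v + (κ * p i + y * odd i) * (w * v)
        ≡⟨ collect κ θ y w a (p i) (q i) v ⟩
      (p i + θ * q i + y * q i) * v + (even i + y * odd i) * (w * v)
        ≡⟨ cong (λ t → (p i + θ * q i + y * q i) * v + (even i + y * odd i) * t) (split i i∈R) ⟩
      (p i + θ * q i + y * q i) * v + (even i + y * odd i) * (z i * (w - v))
        ≡⟨ distribute y w (p i) (q i) v (z i) (θ * q i) (even i) (odd i) ⟩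
      w * (y * (z i * odd i) + z i * even i) + (p⁺ (suc i) + y * q⁺ (suc i)) * v ∎
      where
      w v : ℚ
      w = W zero
      v = W (suc i)
      expand : ∀ κ θ y w p q v →
        (1ℚ + (κ + θ * y) * w) * ((p + y * q) * v)
          ≡ (p + y * q) * v + θ * q * (y * y * w) * v + (κ * p + y * (θ * p + κ * q)) * (w * v)
      expand = solve-∀ ring
      collect : ∀ κ θ y w a p q v →
        (p + y * q) * v + θ * q * (1ℚ + a * w) * v + (κ * p + y * (θ * p + κ * q)) * (w * v)
          ≡ (p + θ * q + y * q) * v + (κ * p + θ * a * q + y * (θ * p + κ * q)) * (w * v)
      collect = solve-∀ ring
      distribute : ∀ y w p q v z t e o →
        (p + t + y * q) * v + (e + y * o) * (z * (w - v))
          ≡ w * (y * (z * o) + z * e) + (p + t - z * e + y * (q - z * o)) * v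
      distribute = solve-∀ ring

    expansion-step : (1ℚ + (κ + θ * y) * W zero) * expansion R (W ∘ suc) p q y
                     ≡ expansion (inside ∷ R) W p⁺ q⁺ y
    expansion-step = begin
      (1ℚ + c * w) * (1ℚ + sumOver R f)
        ≡⟨ *-distribˡ-+ (1ℚ + c * w) 1ℚ (sumOver R f) ⟩
      (1ℚ + c * w) * 1ℚ + (1ℚ + c * w) * sumOver R f
        ≡⟨ cong₂ _+_ (*-identityʳ (1ℚ + c * w)) (sym (sumOver-*ˡ R (1ℚ + c * w) f)) ⟩
      1ℚ + c * w + sumOver R (λ i → (1ℚ + c * w) * f i)
        ≡⟨ cong (1ℚ + c * w +_) (sumOver-cong R term) ⟩
      1ℚ + c * w + sumOver R (λ i → w * (y * zo i + ze i) + g i)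
        ≡⟨ cong (1ℚ + c * w +_) (sumOver-linear R w (λ i → y * zo i + ze i) g) ⟩
      1ℚ + c * w + (w * sumOver R (λ i → y * zo i + ze i) + sumOver R g)
        ≡⟨ cong (λ t → 1ℚ + c * w + (w * t + sumOver R g)) (sumOver-linear R y zo ze) ⟩
      1ℚ + c * w + (w * (y * sumOver R zo + sumOver R ze) + sumOver R g)
        ≡⟨ regroup κ θ y w (sumOver R ze) (sumOver R zo) (sumOver R g) ⟩
      1ℚ + ((p⁺ zero + y * q⁺ zero) * w + sumOver R g) ∎
      where
      c w : ℚ
      c = κ + θ * y
      w = W zero
      f g ze zo : Fin k → ℚ
      f i  = (p i + y * q i) * W (suc i)
      g i  = (p⁺ (suc i) + y * q⁺ (suc i)) * W (suc i)
      ze i = z i * even i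
      zo i = z i * odd i
      regroup : ∀ κ θ y w A B G →
        1ℚ + (κ + θ * y) * w + (w * (y * B + A) + G) ≡ 1ℚ + ((κ + A + y * (θ + B)) * w + G)
      regroup = solve-∀ ring

Admissible : ∀ {k} → (Fin k → ℚ) → Subset k → ℚ → Set
Admissible ℓ R x = ∀ i → i ∈ R → (x + toℚ 2 - ℓ i ≢ 0ℚ) × (x + ℓ i ≢ 0ℚ)

admissible-tail : ∀ {k} (ℓ : Fin (suc k) → ℚ) {b R} x →
                  Admissible ℓ (b ∷ R) x → Admissible (ℓ ∘ suc) R x
admissible-tail ℓ x adm i i∈R = adm (suc i) (there i∈R)

record Expansion {k} (ℓ : Fin k → ℚ) (I J R : Subset k) : Set where
  constructor mkExpansion
  field
    p q     : Fin k → ℚ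
    expands : ∀ x → Admissible ℓ R x →
        prodOver₂ I J (P x ∘ ℓ) (Q x ∘ ℓ) ≡ expansion R (λ i → 1ℚ /' D x (ℓ i)) p q (x + 1ℚ)
      × prodOver₂ I J (Q x ∘ ℓ) (P x ∘ ℓ) ≡ expansion R (λ i → 1ℚ /' D x (ℓ i)) p q (- (x + 1ℚ))

expansion-skip : ∀ {k} (ℓ : Fin (suc k) → ℚ) {I J R} →
  Expansion (ℓ ∘ suc) I J R → Expansion ℓ (outside ∷ I) (outside ∷ J) (outside ∷ R)
expansion-skip ℓ (mkExpansion p q expands) =
  mkExpansion (0ℚ Vector.∷ p) (0ℚ Vector.∷ q) (λ x → expands x ∘ admissible-tail ℓ x)

expansion-extend : ∀ {k} (ℓ : Fin (suc k) → ℚ) → Injective _≡_ _≡_ (σ ∘ ℓ) → ∀ bI bJ {I J R} →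
  Expansion (ℓ ∘ suc) I J R → Expansion ℓ (bI ∷ I) (bJ ∷ J) (inside ∷ R)
expansion-extend {k} ℓ σℓ-injective bI bJ {I} {J} {R} (mkExpansion p q expands) =
  mkExpansion p⁺ q⁺ expands⁺
  where
  l : ℚ
  l = ℓ zero
  z : Fin k → ℚ
  z i = 1ℚ /' (σ l - σ (ℓ (suc i)))
  open Extension R z p q (σ l) (κ bI bJ l) (θ bI bJ l)

  σ-distinct : ∀ i → σ l - σ (ℓ (suc i)) ≢ 0ℚ
  σ-distinct i = Fin.0≢1+n ∘ σℓ-injective ∘ x∙y⁻¹≈ε⇒x≈y +-0-group (σ l) (σ (ℓ (suc i)))

  neg-square : ∀ y → - y * - y ≡ y * y
  neg-square = solve-∀ ring

  module _ (x : ℚ) (adm : Admissible ℓ (inside ∷ R) x) where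
    W : Fin (suc k) → ℚ
    W i = 1ℚ /' D x (ℓ i)

    D*W≡1 : ∀ i → i ∈ inside ∷ R → D x (ℓ i) * W i ≡ 1ℚ
    D*W≡1 i i∈ = 1/'-inverseʳ (x#0y#0→xy#0 (proj₁ (adm i i∈)) (proj₂ (adm i i∈)))

    split : ∀ i → i ∈ R → W zero * W (suc i) ≡ z i * (W zero - W (suc i))
    split i i∈R = partial-fraction (D x l) (D x (ℓ (suc i))) (W zero) (W (suc i)) (z i)
      (D*W≡1 zero here) (D*W≡1 (suc i) (there i∈R))
      (trans (cong (_* z i) (D-difference x l (ℓ (suc i)))) (1/'-inverseʳ (σ-distinct i)))

    multiply : ∀ y → y * y ≡ (x + 1ℚ) * (x + 1ℚ) → ∀ f g →
      f zero ^ᵇ bI * g zero ^ᵇ bJ ≡ 1ℚ + (κ bI bJ l + θ bI bJ l * y) * W zero →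
      prodOver₂ I J (f ∘ suc) (g ∘ suc) ≡ expansion R (W ∘ suc) p q y →
      prodOver₂ (bI ∷ I) (bJ ∷ J) f g ≡ expansion (inside ∷ R) W p⁺ q⁺ y
    multiply y y²≡ f g factor≡ rest≡ = begin
      prodOver₂ (bI ∷ I) (bJ ∷ J) f g
        ≡⟨ prodOver₂-∷ bI bJ I J f g ⟩
      f zero ^ᵇ bI * g zero ^ᵇ bJ * prodOver₂ I J (f ∘ suc) (g ∘ suc)
        ≡⟨ cong₂ _*_ factor≡ rest≡ ⟩
      (1ℚ + (κ bI bJ l + θ bI bJ l * y) * W zero) * expansion R (W ∘ suc) p q y
        ≡⟨ expansion-step W y (trans (cong (_* W zero) y²≡) (square-* x l (D*W≡1 zero here))) split ⟩
      expansion (inside ∷ R) W p⁺ q⁺ y ∎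

    expands⁺ :
        prodOver₂ (bI ∷ I) (bJ ∷ J) (P x ∘ ℓ) (Q x ∘ ℓ) ≡ expansion (inside ∷ R) W p⁺ q⁺ (x + 1ℚ)
      × prodOver₂ (bI ∷ I) (bJ ∷ J) (Q x ∘ ℓ) (P x ∘ ℓ) ≡ expansion (inside ∷ R) W p⁺ q⁺ (- (x + 1ℚ))
    expands⁺ =
        multiply (x + 1ℚ) refl (P x ∘ ℓ) (Q x ∘ ℓ)
          (proj₁ (factor-expansion bI bJ x l (D*W≡1 zero here))) (proj₁ (expands x tail))
      , multiply (- (x + 1ℚ)) (neg-square (x + 1ℚ)) (Q x ∘ ℓ) (P x ∘ ℓ)
          (proj₂ (factor-expansion bI bJ x l (D*W≡1 zero here))) (proj₂ (expands x tail))
      where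
      tail : Admissible (ℓ ∘ suc) R x
      tail = admissible-tail ℓ x adm

expansion-exists : ∀ {k} (ℓ : Fin k → ℚ) → Injective _≡_ _≡_ (σ ∘ ℓ) → (I J : Subset k) →
                   Expansion ℓ I J (I ∪ J)
expansion-exists ℓ _ [] [] = mkExpansion (λ ()) (λ ()) λ _ _ → 1*1≡1+0 , 1*1≡1+0
  where
  1*1≡1+0 : 1ℚ * 1ℚ ≡ 1ℚ + 0ℚ
  1*1≡1+0 = trans (*-identityˡ 1ℚ) (sym (+-identityʳ 1ℚ))
expansion-exists ℓ inj (bI ∷ I) (bJ ∷ J) =
  add bI bJ (expansion-exists (ℓ ∘ suc) (Fin.suc-injective ∘ inj) I J)
  where
  add : ∀ bI bJ → Expansion (ℓ ∘ suc) I J (I ∪ J) →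
        Expansion ℓ (bI ∷ I) (bJ ∷ J) ((bI ∷ I) ∪ (bJ ∷ J))
  add outside outside = expansion-skip ℓ
  add inside  outside = expansion-extend ℓ inj inside outside
  add outside inside  = expansion-extend ℓ inj outside inside
  add inside  inside  = expansion-extend ℓ inj inside inside

elt-nonZero : ∀ n m i → NonZero (elt n m i)
elt-nonZero zero    m i       = _
elt-nonZero (suc n) m zero    = _
elt-nonZero (suc n) m (suc i) = _

elt-injective : ∀ n m → Injective _≡_ _≡_ (elt n m)
elt-injective zero    m {i}     {j}     eq =
  Fin.toℕ-injective (ℕ.suc-injective (ℕ.*-cancelˡ-≡ _ _ 2 eq))
elt-injective (suc n) m {zero}  {zero}  eq = refl
elt-injective (suc n) m {zero}  {suc j} eq =
  contradiction (sym (ℕ.suc-injective eq)) (ℕ.≢-nonZero⁻¹ (elt n m j) {{elt-nonZero n m j}})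
elt-injective (suc n) m {suc i} {zero}  eq =
  contradiction (ℕ.suc-injective eq) (ℕ.≢-nonZero⁻¹ (elt n m i) {{elt-nonZero n m i}})
elt-injective (suc n) m {suc i} {suc j} eq = cong suc (elt-injective n m (ℕ.suc-injective eq))

σ-toℚ : ∀ k → .{{NonZero k}} → σ (toℚ k) ≡ toℚ (pred k ℕ.* pred k)
σ-toℚ (suc a) = begin
  σ (toℚ (suc a))  ≡⟨ cong σ (toℚ-+ 1 a) ⟩
  σ (1ℚ + toℚ a)   ≡⟨ shift (toℚ a) ⟩
  toℚ a * toℚ a    ≡⟨ sym (toℚ-* a a) ⟩
  toℚ (a ℕ.* a)    ∎
  where
  shift : ∀ t → (1ℚ + t - 1ℚ) * (1ℚ + t - 1ℚ) ≡ t * t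
  shift = solve-∀ ring

σ-eltℚ-injective : ∀ n m → Injective _≡_ _≡_ (σ ∘ eltℚ n m)
σ-eltℚ-injective n m {i} {j} eq = elt-injective n m (ℕ.pred-injective {{i≢0}} {{j≢0}}
  (square-injective (toℚ-injective (trans (sym (σ-toℚ _ {{i≢0}})) (trans eq (σ-toℚ _ {{j≢0}}))))))
  where
  i≢0 : NonZero (elt n m i)
  i≢0 = elt-nonZero n m i
  j≢0 : NonZero (elt n m j)
  j≢0 = elt-nonZero n m j

lemma4p2 : (n m : ℕ) (I J : Subset (n Data.Nat.+ m)) →
    Σ (Fin (n Data.Nat.+ m) → ℚ) λ b →
      (x : ℚ) →
      (∀ i → i ∈ (I ∪ J) → (x + toℚ 2 - eltℚ n m i ≢ 0ℚ) × (x + eltℚ n m i ≢ 0ℚ)) →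
      prodOver I (λ i → (x + toℚ 2 + eltℚ n m i) /' (x + toℚ 2 - eltℚ n m i))
        * prodOver J (λ i → (x - eltℚ n m i) /' (x + eltℚ n m i))
      + prodOver I (λ i → (x - eltℚ n m i) /' (x + eltℚ n m i))
        * prodOver J (λ i → (x + toℚ 2 + eltℚ n m i) /' (x + toℚ 2 - eltℚ n m i))
      ≡ toℚ 2 + sumOver (I ∪ J) (λ i → b i /' ((x + toℚ 2 - eltℚ n m i) * (x + eltℚ n m i)))
lemma4p2 n m I J = b , λ x adm → begin
  prodOver₂ I J (P x ∘ ℓ) (Q x ∘ ℓ) + prodOver₂ I J (Q x ∘ ℓ) (P x ∘ ℓ)
    ≡⟨ cong₂ _+_ (proj₁ (expands x adm)) (proj₂ (expands x adm)) ⟩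
  expansion (I ∪ J) (W x) p q (x + 1ℚ) + expansion (I ∪ J) (W x) p q (- (x + 1ℚ))
    ≡⟨ expansion-mirror (I ∪ J) (W x) p q (x + 1ℚ) ⟩
  toℚ 2 + sumOver (I ∪ J) (λ i → b i * W x i)
    ≡⟨ cong (toℚ 2 +_) (sumOver-cong (I ∪ J) (λ i _ → sym (/'-as-* (b i) (D x (ℓ i))))) ⟩
  toℚ 2 + sumOver (I ∪ J) (λ i → b i /' D x (ℓ i)) ∎
  where
  ℓ : Fin (n ℕ.+ m) → ℚ
  ℓ = eltℚ n m
  open Expansion (expansion-exists ℓ (σ-eltℚ-injective n m) I J)
  W : ℚ → Fin (n ℕ.+ m) → ℚ
  W x i = 1ℚ /' D x (ℓ i)
  b : Fin (n ℕ.+ m) → ℚ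
  b i = toℚ 2 * p i
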